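{- Let $G$ be a circuit representing a specification $\varphi_G(\mathbf{X},\mathbf{I})$ and $H$ a circuit representing a specification $\varphi_H(\mathbf{X},\mathbf{X}',\mathbf{I})$, where $\mathbf{X}'$ is a sequence of fresh output variables, and suppose $G$ is equisynthesizable to $H$ under projection. If $(\Psi(\mathbf{I}),\Psi'(\mathbf{I}))$ is a Skolem function vector for $(\mathbf{X},\mathbf{X}')$ in $\varphi_H(\mathbf{X},\mathbf{X}',\mathbf{I})$, then $\Psi(\mathbf{I})$ is a Skolem function vector for $\mathbf{X}$ in $\varphi_G(\mathbf{X},\mathbf{I})$.
   Context: $\mathbf{I}$ (system inputs), $\mathbf{X}$ and $\mathbf{X}'$ (system outputs) are pairwise disjoint sequences of Boolean variables. Circuits are NNF circuits (rooted DAGs with $\wedge$/$\vee$ internal nodes and leaves labeled by literals or constants) and $\varphi_G$ denotes the formula represented by $G$. $G$ is equisynthesizable to $H$ under projection iff $\forall\mathbf{I}\forall\mathbf{X}\,(\varphi_G(\mathbf{X},\mathbf{I})\Rightarrow\exists\mathbf{X}'\,\varphi_H(\mathbf{X},\mathbf{X}',\mathbf{I}))$ and $\forall\mathbf{I}\forall\mathbf{X}\forall\mathbf{X}'\,(\varphi_H(\mathbf{X},\mathbf{X}',\mathbf{I})\Rightarrow\varphi_G(\mathbf{X},\mathbf{I}))$. A Skolem function vector for outputs $\mathbf{Y}$ in a specification $\varphi(\mathbf{Y},\mathbf{I})$ is a sequence $\Psi(\mathbf{I})$ of formulas/circuits over $\mathbf{I}$, one per variable of $\mathbf{Y}$, with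 $\forall\mathbf{I}\,(\varphi(\Psi(\mathbf{I}),\mathbf{I})\Leftrightarrow\exists\mathbf{Y}\,\varphi(\mathbf{Y},\mathbf{I}))$. -}

module Defs where

open import Data.Bool using (Bool; true; false; not; _∧_; _∨_)
open import Data.Nat using (ℕ)
open import Data.Fin using (Fin)
open import Data.Sum using (_⊎_; inj₁; inj₂)
open import Data.Product using (∃; _×_)
open import Relation.Binary.PropositionalEquality using (_≡_)

-- NNF circuits over a type V of variables: leaves are literals or constants,
-- internal nodes are binary ∧ / ∨.  (A DAG with shared subcircuits denotes
-- the same formula as its tree unfolding; sharing is irrelevant for semantics.)
data NNF (V : Set) : Set where
  const : Bool → NNF V
  pos   : V → NNF V
  neg   : V → NNF V
  and   : NNF V → NNF V → NNF V
  or    : NNF V → NNF V → NNF V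

⟦_⟧ : {V : Set} → NNF V → (V → Bool) → Bool
⟦ const b ⟧ ρ = b
⟦ pos v ⟧ ρ = ρ v
⟦ neg v ⟧ ρ = not (ρ v)
⟦ and g h ⟧ ρ = ⟦ g ⟧ ρ ∧ ⟦ h ⟧ ρ
⟦ or g h ⟧ ρ = ⟦ g ⟧ ρ ∨ ⟦ h ⟧ ρ

Asg : ℕ → Set
Asg n = Fin n → Bool

spec2 : {nY nI : ℕ} → NNF (Fin nY ⊎ Fin nI) → Asg nY → Asg nI → Bool
spec2 φ y i = ⟦ φ ⟧ [ y , i ]
  where
  [_,_] : {A B : Set} → (A → Bool) → (B → Bool) → A ⊎ B → Bool
  [ f , g ] (inj₁ a) = f a
  [ f , g ] (inj₂ b) = g b

spec3 : {nX nX' nI : ℕ} → NNF (Fin nX ⊎ (Fin nX' ⊎ Fin nI)) →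
        Asg nX → Asg nX' → Asg nI → Bool
spec3 φ x x' i = ⟦ φ ⟧ ρ
  where
  ρ : _ → Bool
  ρ (inj₁ a) = x a
  ρ (inj₂ (inj₁ b)) = x' b
  ρ (inj₂ (inj₂ c)) = i c

EquisynthProj : {nX nX' nI : ℕ} →
  NNF (Fin nX ⊎ Fin nI) → NNF (Fin nX ⊎ (Fin nX' ⊎ Fin nI)) → Set
EquisynthProj {nX} {nX'} {nI} G H =
  (∀ (i : Asg nI) (x : Asg nX) → spec2 G x i ≡ true →
     ∃ λ (x' : Asg nX') → spec3 H x x' i ≡ true)
  × (∀ (i : Asg nI) (x : Asg nX) (x' : Asg nX') →
     spec3 H x x' i ≡ true → spec2 G x i ≡ true)

evalVec : {n nI : ℕ} → (Fin n → NNF (Fin nI)) → Asg nI → Asg n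
evalVec Ψ i k = ⟦ Ψ k ⟧ i

Skolem2 : {nY nI : ℕ} → NNF (Fin nY ⊎ Fin nI) → (Fin nY → NNF (Fin nI)) → Set
Skolem2 {nY} {nI} φ Ψ = ∀ (i : Asg nI) →
  (spec2 φ (evalVec Ψ i) i ≡ true → ∃ λ (y : Asg nY) → spec2 φ y i ≡ true)
  × ((∃ λ (y : Asg nY) → spec2 φ y i ≡ true) → spec2 φ (evalVec Ψ i) i ≡ true)

Skolem3 : {nX nX' nI : ℕ} → NNF (Fin nX ⊎ (Fin nX' ⊎ Fin nI)) →
  (Fin nX → NNF (Fin nI)) → (Fin nX' → NNF (Fin nI)) → Set
Skolem3 {nX} {nX'} {nI} φ Ψ Ψ' = ∀ (i : Asg nI) →
  (spec3 φ (evalVec Ψ i) (evalVec Ψ' i) i ≡ true →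
     ∃ λ (x : Asg nX) → ∃ λ (x' : Asg nX') → spec3 φ x x' i ≡ true)
  × ((∃ λ (x : Asg nX) → ∃ λ (x' : Asg nX') → spec3 φ x x' i ≡ true) →
     spec3 φ (evalVec Ψ i) (evalVec Ψ' i) i ≡ true)

module Submission where

open import Defs
open import Data.Nat using (ℕ)
open import Data.Fin using (Fin)
open import Data.Sum using (_⊎_)
open import Data.Bool using (true)
open import Data.Product using (∃; _,_; proj₂)
open import Relation.Binary.PropositionalEquality using (_≡_)

-- Any G-witness x extends to an H-witness (x, x'); Skolem completeness for H then
-- makes (Ψ, Ψ') an H-solution, whose projection Ψ satisfies G.

spec2-witness : {nY nI : ℕ} (φ : NNF (Fin nY ⊎ Fin nI)) (Ψ : Fin nY → NNF (Fin nI))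
  (i : Asg nI) → spec2 φ (evalVec Ψ i) i ≡ true → ∃ λ (y : Asg nY) → spec2 φ y i ≡ true
spec2-witness φ Ψ i sat = evalVec Ψ i , sat

equisynthProj-skolem-complete : {nX nX' nI : ℕ}
  (G : NNF (Fin nX ⊎ Fin nI)) (H : NNF (Fin nX ⊎ (Fin nX' ⊎ Fin nI))) →
  EquisynthProj G H →
  (Ψ : Fin nX → NNF (Fin nI)) (Ψ' : Fin nX' → NNF (Fin nI)) → Skolem3 H Ψ Ψ' →
  (i : Asg nI) → (∃ λ (x : Asg nX) → spec2 G x i ≡ true) → spec2 G (evalVec Ψ i) i ≡ true
equisynthProj-skolem-complete G H (extend , project) Ψ Ψ' skolemH i (x , Gx) =
  let (x' , Hxx') = extend i x Gx
  in project i (evalVec Ψ i) (evalVec Ψ' i) (proj₂ (skolemH i) (x , x' , Hxx'))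

lemma3 : {nX nX' nI : ℕ} →
    (G : NNF (Fin nX ⊎ Fin nI)) →
    (H : NNF (Fin nX ⊎ (Fin nX' ⊎ Fin nI))) →
    EquisynthProj G H →
    (Ψ : Fin nX → NNF (Fin nI)) → (Ψ' : Fin nX' → NNF (Fin nI)) →
    Skolem3 H Ψ Ψ' →
    Skolem2 G Ψ
lemma3 G H equi Ψ Ψ' skolemH i =
  spec2-witness G Ψ i , equisynthProj-skolem-complete G H equi Ψ Ψ' skolemH i
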